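{- Let $n,k$ be integers with $2 \leq k \leq n-2$, and let $E \subset F^n$ be an $(n,k)$ set. Then $\lvert E \rvert \gtrapprox \lvert F \rvert^{\frac{kn+k+1}{k+1}}$.
   Context: $F$ is a finite field (thought of as large; $n,k$ fixed, constants independent of $F$). An $(n,k)$ set in $F^n$ is a set $E\subset F^n$ such that for every $k$-dimensional linear subspace $\pi\subset F^n$ there is $x\in F^n$ with $x+\pi\subset E$. $\lvert\cdot\rvert$ denotes cardinality. $A\gtrapprox B$ means that for every $\epsilon>0$ there is a constant $C_\epsilon>0$, independent of $F$, with $B\le C_\epsilon\lvert F\rvert^{\epsilon}A$.
   Formalization: The parameter ε in the definition of ⪆ ranges only over the positive rationals. -}

module Defs where

open import Data.Nat using (ℕ; _*_; _^_; _≤_; _+_)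
open import Data.Fin using (Fin)
open import Data.Vec using (Vec; zipWith; map; replicate; foldr)
open import Data.List using (List; length)
open import Data.List.Relation.Unary.Unique.Propositional using (Unique)
open import Data.List.Membership.Propositional using (_∈_)
open import Data.Product using (∃; _×_)
open import Relation.Binary.PropositionalEquality using (_≡_)
open import Relation.Nullary using (¬_)
open import Function.Bundles using (_↔_)
open import Algebra.Structures using (IsCommutativeRing)

record FiniteField : Set₁ where
  infixl 6 _+F_
  infixl 7 _*F_
  field
    Carrier : Set
    _+F_ _*F_ : Carrier → Carrier → Carrier
    -F_ : Carrier → Carrier
    0F 1F : Carrier
    isCommutativeRing : IsCommutativeRing _≡_ _+F_ _*F_ -F_ 0F 1F
    0≢1 : ¬ (0F ≡ 1F)
    inverse : ∀ x → ¬ (x ≡ 0F) → ∃ λ y → x *F y ≡ 1F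
    size : ℕ
    enum : Fin size ↔ Carrier

module _ (F : FiniteField) where
  open FiniteField F

  Pt : ℕ → Set
  Pt n = Vec Carrier n

  _⊕_ : ∀ {n} → Pt n → Pt n → Pt n
  _⊕_ = zipWith _+F_

  _·_ : ∀ {n} → Carrier → Pt n → Pt n
  c · v = map (c *F_) v

  zeroVec : ∀ n → Pt n
  zeroVec n = replicate n 0F

  lincomb : ∀ {n k} → Vec Carrier k → Vec (Pt n) k → Pt n
  lincomb {n} ts vs = foldr (λ _ → Pt n) _⊕_ (zeroVec n) (zipWith _·_ ts vs)

  LinIndep : ∀ {n k} → Vec (Pt n) k → Set
  LinIndep {n} {k} vs = ∀ ts → lincomb ts vs ≡ zeroVec n → ts ≡ replicate k 0F

  -- the k-dimensional linear subspace spanned by the linearly independent vs;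
  -- every k-dimensional subspace arises this way.
  InSpan : ∀ {n k} → Vec (Pt n) k → Pt n → Set
  InSpan vs y = ∃ λ ts → y ≡ lincomb ts vs

  -- E ⊂ F^n given as a duplicate-free list of points; |E| = length E.
  -- (n,k) set: every k-dimensional subspace π has a translate x + π ⊂ E.
  IsNKSet : (n k : ℕ) → List (Pt n) → Set
  IsNKSet n k E = ∀ (vs : Vec (Pt n) k) → LinIndep vs →
    ∃ λ (x : Pt n) → ∀ (y : Pt n) → InSpan vs y → (x ⊕ y) ∈ E

module Submission where

-- Dvir's polynomial method gives the stronger bound |E| ≥ |F|ⁿ / nⁿ, which suffices because k + 1 ≤ n
-- makes q(kn + k + 1) ≤ n · q(k + 1).  An (n,k) set with k ≥ 1 contains a line in every direction.  If |E|
-- were smaller than the number C(n + d, n) of monomials of degree ≤ d = |F| − 1, two distinct polynomials of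
-- degree ≤ d would agree on E, so a nonzero one P would vanish on E.  On a line of E with direction v, P
-- restricts to a polynomial of degree ≤ d < |F| vanishing on all of F, so its leading coefficient, the top
-- form of P at v, is zero; the top form thus vanishes at every direction, hence is the zero polynomial, and
-- induction on the degree gives P = 0.  Finally C(n + d, n) ≥ |F|ⁿ / nⁿ.

open import Defs
open import Data.Nat using (ℕ; zero; suc; _≤_; _<_; _^_; s≤s; z≤n)
import Data.Nat.Properties as ℕ
open import Data.Fin using (Fin)
import Data.Fin.Properties as Fin
open import Data.Vec as V using (Vec; []; _∷_; replicate)
import Data.Vec.Properties as V
open import Data.List as L using (List; length; allFin)
open import Data.List.Properties using (length-map; length-tabulate)
open import Data.List.Membership.Propositional using (_∈_)
open import Data.List.Relation.Unary.Any using (here; there)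
import Data.List.Relation.Unary.All as All
open import Data.List.Relation.Unary.AllPairs using (_∷_)
open import Data.List.Relation.Unary.Unique.Propositional using (Unique)
open import Data.List.Relation.Unary.Unique.Propositional.Properties using (map⁺; allFin⁺)
open import Data.Product using (Σ; ∃; _×_; _,_; proj₂; uncurry)
open import Data.Product.Function.NonDependent.Propositional using (_×-↔_)
open import Data.Unit using (tt)
open import Data.Empty using (⊥-elim)
open import Function using (_∘_; id)
open import Function.Bundles using (Inverse; Injection; _↔_; mk↔ₛ′)
open import Function.Properties.Inverse using (↔-trans; ↔-sym; Inverse⇒Injection)
open import Function.Definitions using (Injective)
open import Relation.Binary.PropositionalEquality
open import Relation.Nullary using (¬_)
open import Algebra.Bundles using (CommutativeRing)

module Monomials where
  open import Data.Nat
  open import Data.Nat.Properties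
  open import Data.Nat.DivMod using (_/_; _%_; m≡m%n+[m/n]*n; m%n<n; m/n*n≤m)
  open import Algebra.Properties.CommutativeSemigroup *-commutativeSemigroup using (interchange)
  open ≤-Reasoning

  -- The number C(N + d − 1, d) of coefficients of a Hom N d below, counted along the same recursion.
  monomialCount : ℕ → ℕ → ℕ
  monomialCount _       zero    = 1
  monomialCount zero    (suc d) = 0
  monomialCount (suc N) (suc d) = monomialCount N (suc d) + monomialCount (suc N) d

  monomialCount-1 : ∀ d → monomialCount 1 d ≡ 1
  monomialCount-1 zero    = refl
  monomialCount-1 (suc d) = monomialCount-1 d

  monomialCount-mono-vars : ∀ N d → monomialCount N d ≤ monomialCount (suc N) d
  monomialCount-mono-vars N       zero    = ≤-refl
  monomialCount-mono-vars N       (suc d) = m≤m+n _ _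

  monomialCount-mono-deg : ∀ n j d → monomialCount (suc n) d ≤ monomialCount (suc n) (j + d)
  monomialCount-mono-deg n zero    d = ≤-refl
  monomialCount-mono-deg n (suc j) d = ≤-trans (monomialCount-mono-deg n j d) (m≤n+m _ _)

  *-monomialCount≤ : ∀ n m d → suc m * monomialCount (suc n) d ≤ monomialCount (suc (suc n)) (m + d)
  *-monomialCount≤ n zero    d = begin
    monomialCount (suc n) d + 0       ≡⟨ +-identityʳ _ ⟩
    monomialCount (suc n) d           ≤⟨ monomialCount-mono-vars (suc n) d ⟩
    monomialCount (suc (suc n)) d     ∎
  *-monomialCount≤ n (suc m) d = +-mono-≤ (monomialCount-mono-deg n (suc m) d) (*-monomialCount≤ n m d)

  ^≤monomialCount : ∀ n a d → n * a ≤ d → suc a ^ n ≤ monomialCount (suc n) d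
  ^≤monomialCount zero    a d _   = ≤-reflexive (sym (monomialCount-1 d))
  ^≤monomialCount (suc n) a d n+1*a≤d = begin
    suc a * suc a ^ n                        ≤⟨ *-monoʳ-≤ (suc a) (^≤monomialCount n a (d ∸ a) n*a≤d∸a) ⟩
    suc a * monomialCount (suc n) (d ∸ a)    ≤⟨ *-monomialCount≤ n a (d ∸ a) ⟩
    monomialCount (suc (suc n)) (a + (d ∸ a)) ≡⟨ cong (monomialCount (suc (suc n))) (m+[n∸m]≡n a≤d) ⟩
    monomialCount (suc (suc n)) d            ∎
    where
    a≤d : a ≤ d
    a≤d = ≤-trans (m≤m+n a (n * a)) n+1*a≤d
    n*a≤d∸a : n * a ≤ d ∸ a
    n*a≤d∸a = +-cancelˡ-≤ a (n * a) (d ∸ a) (≤-trans n+1*a≤d (≤-reflexive (sym (m+[n∸m]≡n a≤d))))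

  ^-distribʳ-* : ∀ a b e → (a * b) ^ e ≡ a ^ e * b ^ e
  ^-distribʳ-* a b zero    = refl
  ^-distribʳ-* a b (suc e) = trans (cong (a * b *_) (^-distribʳ-* a b e)) (interchange a b (a ^ e) (b ^ e))

  -- With a = ⌊(S − 1)/n⌋ one has S ≤ n(a + 1) and n·a ≤ S − 1.
  ^≤^*monomialCount : ∀ n S → S ^ n ≤ n ^ n * monomialCount (suc n) (S ∸ 1)
  ^≤^*monomialCount zero    S        = ≤-reflexive (sym (trans (+-identityʳ _) (monomialCount-1 (S ∸ 1))))
  ^≤^*monomialCount (suc _) zero     = z≤n
  ^≤^*monomialCount n@(suc _) (suc S) = begin
    suc S ^ n                ≤⟨ ^-monoˡ-≤ n suc-S≤n*suc-a ⟩
    (n * suc a) ^ n          ≡⟨ ^-distribʳ-* n (suc a) n ⟩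
    n ^ n * suc a ^ n        ≤⟨ *-monoʳ-≤ (n ^ n) (^≤monomialCount n a S n*a≤S) ⟩
    n ^ n * monomialCount (suc n) S ∎
    where
    a = S / n
    n*a≤S : n * a ≤ S
    n*a≤S = ≤-trans (≤-reflexive (*-comm n a)) (m/n*n≤m S n)
    suc-S≤n*suc-a : suc S ≤ n * suc a
    suc-S≤n*suc-a = begin
      suc S                ≡⟨ cong suc (m≡m%n+[m/n]*n S n) ⟩
      suc (S % n + a * n)  ≤⟨ +-monoˡ-≤ (a * n) (m%n<n S n) ⟩
      n + a * n            ≡⟨ *-comm (suc a) n ⟩
      n * suc a            ∎

open Monomials using (monomialCount; ^≤^*monomialCount; ^-distribʳ-*)

to-injective : ∀ {A B : Set} (e : A ↔ B) → Injective _≡_ _≡_ (Inverse.to e)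
to-injective e = Injection.injective (Inverse⇒Injection e)

Fin↔-distinct⇒1< : ∀ {A : Set} {n} → Fin n ↔ A → ∀ {x y : A} → ¬ x ≡ y → 1 < n
Fin↔-distinct⇒1< {n = zero}        e {x} _   = ⊥-elim (Fin.¬Fin0 (Inverse.from e x))
Fin↔-distinct⇒1< {n = suc zero}    e     x≢y =
  ⊥-elim (x≢y (to-injective (↔-sym e) (to-injective Fin.1↔⊤ refl)))
Fin↔-distinct⇒1< {n = suc (suc _)} _     _   = s≤s (s≤s z≤n)

module Finite {A : Set} {s : ℕ} (enum : Fin s ↔ A) where

  Fin^↔Vec : ∀ m → Fin (s ^ m) ↔ Vec A m
  Fin^↔Vec zero    = ↔-trans Fin.1↔⊤ (mk↔ₛ′ (λ _ → []) (λ _ → tt) (λ { [] → refl }) (λ _ → refl))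
  Fin^↔Vec (suc m) = ↔-trans Fin.*↔× (↔-trans (enum ×-↔ Fin^↔Vec m)
                       (mk↔ₛ′ (uncurry _∷_) V.uncons (λ { (_ ∷ _) → refl }) (λ _ → refl)))

  Vec-injection⇒≤ : 1 < s → ∀ {m n} (f : Vec A m → Vec A n) → Injective _≡_ _≡_ f → m ≤ n
  Vec-injection⇒≤ 1<s {m} {n} f f-injective = ℕ.≮⇒≥ λ n<m →
    ℕ.<⇒≱ (ℕ.^-monoʳ-< s 1<s n<m)
      (Fin.injective⇒≤ {f = Inverse.from (Fin^↔Vec n) ∘ f ∘ Inverse.to (Fin^↔Vec m)}
        (to-injective (Fin^↔Vec m) ∘ f-injective ∘ to-injective (↔-sym (Fin^↔Vec n))))

map-fromList-≡⇒≡ : ∀ {A B : Set} (f g : A → B) (xs : List A) →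
  V.map f (V.fromList xs) ≡ V.map g (V.fromList xs) → ∀ {x} → x ∈ xs → f x ≡ g x
map-fromList-≡⇒≡ f g (_ L.∷ _)  eq (here refl)  = V.∷-injectiveˡ eq
map-fromList-≡⇒≡ f g (_ L.∷ xs) eq (there x∈xs) = map-fromList-≡⇒≡ f g xs (V.∷-injectiveʳ eq) x∈xs

module PolynomialMethod (F : FiniteField) where

  open FiniteField F using (Carrier; isCommutativeRing; 0≢1; inverse; size; enum)

  commutativeRing : CommutativeRing _ _
  commutativeRing = record { isCommutativeRing = isCommutativeRing }

  open CommutativeRing commutativeRing
    using (_+_; _*_; -_; _-_; 0#; 1#; +-identityˡ; +-identityʳ; *-identityˡ; *-identityʳ; zeroˡ; zeroʳ;
           -‿inverseʳ; *-comm; *-assoc; +-group; +-commutativeSemigroup; +-abelianGroup; ring; commutativeSemiring)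
  open import Algebra.Definitions (_≡_ {A = Carrier}) using (AlmostLeftCancellative)
  open import Algebra.Properties.Ring ring using ([y-z]x≈yx-zx; x[y-z]≈xy-xz)
  open import Algebra.Properties.Group +-group using (x∙y⁻¹≈ε⇒x≈y; x≈y⇒x∙y⁻¹≈ε)
  open import Algebra.Properties.AbelianGroup +-abelianGroup using (⁻¹-∙-comm)
  open import Algebra.Properties.CommutativeSemigroup +-commutativeSemigroup using (interchange)
  open import Algebra.Solver.Ring.NaturalCoefficients.Default commutativeSemiring using (solve; _:=_; _:+_; _:*_)
  open ≡-Reasoning

  *-almostCancelˡ : AlmostLeftCancellative 0# _*_
  *-almostCancelˡ x y z x≢0 xy≡xz with inverse x x≢0
  ... | x⁻¹ , x*x⁻¹≡1 = begin
    y              ≡⟨ x⁻¹*[x*w]≡w y ⟨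
    x⁻¹ * (x * y)  ≡⟨ cong (x⁻¹ *_) xy≡xz ⟩
    x⁻¹ * (x * z)  ≡⟨ x⁻¹*[x*w]≡w z ⟩
    z              ∎
    where
    x⁻¹*[x*w]≡w : ∀ w → x⁻¹ * (x * w) ≡ w
    x⁻¹*[x*w]≡w w = begin
      x⁻¹ * (x * w)  ≡⟨ *-assoc x⁻¹ x w ⟨
      x⁻¹ * x * w    ≡⟨ cong (_* w) (trans (*-comm x⁻¹ x) x*x⁻¹≡1) ⟩
      1# * w         ≡⟨ *-identityˡ w ⟩
      w              ∎

  ≢⇒*-≡⇒≡0 : ∀ {r s x} → ¬ r ≡ s → r * x ≡ s * x → x ≡ 0#
  ≢⇒*-≡⇒≡0 {r} {s} {x} r≢s rx≡sx =
    *-almostCancelˡ (s - r) x 0# (r≢s ∘ sym ∘ x∙y⁻¹≈ε⇒x≈y s r) (begin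
    (s - r) * x        ≡⟨ [y-z]x≈yx-zx x s r ⟩
    s * x - r * x      ≡⟨ cong (λ y → s * x - y) rx≡sx ⟩
    s * x - s * x      ≡⟨ -‿inverseʳ (s * x) ⟩
    0#                 ≡⟨ zeroʳ (s - r) ⟨
    (s - r) * 0#       ∎)

  -- horner cs t s = c₀ + s (c₁ + ⋯ + s (c_{d−1} + s t)), a polynomial of degree ≤ d whose leading
  -- coefficient t is kept apart from the others.
  horner : ∀ {d} → Vec Carrier d → Carrier → Carrier → Carrier
  horner []       t s = t
  horner (c ∷ cs) t s = c + s * horner cs t s

  -- The factor theorem p(s) = p(r) + (s − r) q(s), with both sides moved so that it is a semiring identity.
  horner-factor : ∀ {d} (cs : Vec Carrier (suc d)) t r → ∃ λ (cs′ : Vec Carrier d) →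
    ∀ s → horner cs t s + r * horner cs′ t s ≡ horner cs t r + s * horner cs′ t s
  horner-factor (c ∷ []) t r = [] , λ s →
    solve 4 (λ c t r s → (c :+ s :* t) :+ r :* t := (c :+ r :* t) :+ s :* t) refl c t r s
  horner-factor (c ∷ cs@(_ ∷ _)) t r with horner-factor cs t r
  ... | cs′ , factor = (horner cs t r ∷ cs′) , λ s → let p = horner cs t ; q = horner cs′ t in begin
    (c + s * p s) + r * (p r + s * q s)  ≡⟨ solve 6 (λ c s r ps pr qs →
        (c :+ s :* ps) :+ r :* (pr :+ s :* qs) := (c :+ r :* pr) :+ s :* (ps :+ r :* qs))
        refl c s r (p s) (p r) (q s) ⟩
    (c + r * p r) + s * (p s + r * q s)  ≡⟨ cong (λ y → (c + r * p r) + s * y) (factor s) ⟩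
    (c + r * p r) + s * (p r + s * q s)  ∎

  leading-coefficient≡0 : ∀ {d} (cs : Vec Carrier d) t {rs : List Carrier} → Unique rs → d < length rs →
    (∀ {r} → r ∈ rs → horner cs t r ≡ 0#) → t ≡ 0#
  leading-coefficient≡0 []          t {r L.∷ _}  _                  _             roots = roots (here refl)
  leading-coefficient≡0 cs@(_ ∷ _) t {r L.∷ rs} (r∉rs ∷ rs-unique) (s≤s d<|rs|) roots with horner-factor cs t r
  ... | cs′ , factor = leading-coefficient≡0 cs′ t rs-unique d<|rs| λ {s} s∈rs →
    ≢⇒*-≡⇒≡0 (All.lookup r∉rs s∈rs) (begin
      r * horner cs′ t s                    ≡⟨ +-identityˡ _ ⟨
      0# + r * horner cs′ t s               ≡⟨ cong (_+ r * horner cs′ t s) (roots (there s∈rs)) ⟨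
      horner cs t s + r * horner cs′ t s    ≡⟨ factor s ⟩
      horner cs t r + s * horner cs′ t s    ≡⟨ cong (_+ s * horner cs′ t s) (roots (here refl)) ⟩
      0# + s * horner cs′ t s               ≡⟨ +-identityˡ _ ⟩
      s * horner cs′ t s                    ∎)

  0#+x*0#≡0# : ∀ x → 0# + x * 0# ≡ 0#
  0#+x*0#≡0# x = trans (+-identityˡ (x * 0#)) (zeroʳ x)

  horner-zeros : ∀ d s → horner (replicate d 0#) 0# s ≡ 0#
  horner-zeros zero    s = refl
  horner-zeros (suc d) s = trans (cong (λ y → 0# + s * y) (horner-zeros d s)) (0#+x*0#≡0# s)

  horner-+-affine* : ∀ {d} (cs₀ : Vec Carrier (suc d)) t₀ (cs₁ : Vec Carrier d) t₁ x v →
    ∃ λ (cs : Vec Carrier (suc d)) →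
      ∀ s → horner cs₀ t₀ s + (x + s * v) * horner cs₁ t₁ s ≡ horner cs (t₀ + v * t₁) s
  horner-+-affine* (a ∷ []) t₀ [] t₁ x v = (a + x * t₁ ∷ []) , λ s →
    solve 6 (λ a x t₁ s t₀ v →
      (a :+ s :* t₀) :+ (x :+ s :* v) :* t₁ := (a :+ x :* t₁) :+ s :* (t₀ :+ v :* t₁))
      refl a x t₁ s t₀ v
  horner-+-affine* (a ∷ c ∷ cs₀) t₀ (b ∷ cs₁) t₁ x v
    with horner-+-affine* (c + v * b ∷ cs₀) t₀ cs₁ t₁ x v
  ... | cs , combine = (a + x * b ∷ cs) , λ s → let p = horner cs₀ t₀ s ; q = horner cs₁ t₁ s in begin
    (a + s * (c + s * p)) + (x + s * v) * (b + s * q)          ≡⟨ solve 8 (λ a s c p x v b q →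
        (a :+ s :* (c :+ s :* p)) :+ (x :+ s :* v) :* (b :+ s :* q)
          := (a :+ x :* b) :+ s :* (((c :+ v :* b) :+ s :* p) :+ (x :+ s :* v) :* q))
        refl a s c p x v b q ⟩
    (a + x * b) + s * ((c + v * b + s * p) + (x + s * v) * q)  ≡⟨ cong (λ y → (a + x * b) + s * y) (combine s) ⟩
    (a + x * b) + s * horner cs (t₀ + v * t₁) s                ∎

  infixl 6 _+x₀*_ _-ₕ_

  -- Homogeneous polynomials of degree d in N variables, P₀ +x₀* P₁ standing for
  -- P₀(x₁, …) + x₀ · P₁(x₀, x₁, …).  A polynomial of degree ≤ d on Fⁿ enters through its
  -- homogenisation P : Hom (suc n) d, as x ↦ eval P (1# ∷ x).
  data Hom : ℕ → ℕ → Set where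
    const  : ∀ {N} → Carrier → Hom N zero
    empty  : ∀ {d} → Hom zero (suc d)
    _+x₀*_ : ∀ {N d} → Hom N (suc d) → Hom (suc N) d → Hom (suc N) (suc d)

  eval : ∀ {N d} → Hom N d → Pt F N → Carrier
  eval (const c)    _        = c
  eval empty        []       = 0#
  eval (P₀ +x₀* P₁) (x ∷ xs) = eval P₀ xs + x * eval P₁ (x ∷ xs)

  0ₕ : ∀ {N d} → Hom N d
  0ₕ {_}     {zero}  = const 0#
  0ₕ {zero}  {suc d} = empty
  0ₕ {suc N} {suc d} = 0ₕ +x₀* 0ₕ

  eval-0ₕ : ∀ {N d} (x : Pt F N) → eval (0ₕ {N} {d}) x ≡ 0#
  eval-0ₕ {_}     {zero}  _        = refl
  eval-0ₕ {zero}  {suc d} []       = refl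
  eval-0ₕ {suc N} {suc d} (x ∷ xs) =
    trans (cong₂ (λ a b → a + x * b) (eval-0ₕ {d = suc d} xs) (eval-0ₕ {d = d} (x ∷ xs))) (0#+x*0#≡0# x)

  eval-≡0ₕ : ∀ {N d} {P : Hom N d} → P ≡ 0ₕ → ∀ x → eval P x ≡ 0#
  eval-≡0ₕ {d = d} refl = eval-0ₕ {d = d}

  _-ₕ_ : ∀ {N d} → Hom N d → Hom N d → Hom N d
  const a      -ₕ const b      = const (a - b)
  empty        -ₕ empty        = empty
  (P₀ +x₀* P₁) -ₕ (Q₀ +x₀* Q₁) = (P₀ -ₕ Q₀) +x₀* (P₁ -ₕ Q₁)

  eval--ₕ : ∀ {N d} (P Q : Hom N d) x → eval (P -ₕ Q) x ≡ eval P x - eval Q x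
  eval--ₕ (const a)    (const b)    _        = refl
  eval--ₕ empty        empty        []       = sym (-‿inverseʳ 0#)
  eval--ₕ (P₀ +x₀* P₁) (Q₀ +x₀* Q₁) (x ∷ xs) = begin
    eval (P₀ -ₕ Q₀) xs + x * eval (P₁ -ₕ Q₁) (x ∷ xs)
      ≡⟨ cong₂ (λ a b → a + x * b) (eval--ₕ P₀ Q₀ xs) (eval--ₕ P₁ Q₁ (x ∷ xs)) ⟩
    (p₀ - q₀) + x * (p₁ - q₁)        ≡⟨ cong ((p₀ - q₀) +_) (x[y-z]≈xy-xz x p₁ q₁) ⟩
    (p₀ - q₀) + (x * p₁ - x * q₁)    ≡⟨ interchange p₀ (- q₀) (x * p₁) (- (x * q₁)) ⟩
    (p₀ + x * p₁) + (- q₀ - x * q₁)  ≡⟨ cong ((p₀ + x * p₁) +_) (⁻¹-∙-comm q₀ (x * q₁)) ⟩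
    (p₀ + x * p₁) - (q₀ + x * q₁)    ∎
    where
    p₀ = eval P₀ xs
    p₁ = eval P₁ (x ∷ xs)
    q₀ = eval Q₀ xs
    q₁ = eval Q₁ (x ∷ xs)

  const-injective : ∀ {N a b} → const {N} a ≡ const b → a ≡ b
  const-injective refl = refl

  +x₀*-injective : ∀ {N d} {P₀ Q₀ : Hom N (suc d)} {P₁ Q₁ : Hom (suc N) d} →
    P₀ +x₀* P₁ ≡ Q₀ +x₀* Q₁ → P₀ ≡ Q₀ × P₁ ≡ Q₁
  +x₀*-injective refl = refl , refl

  -ₕ≡0ₕ⇒≡ : ∀ {N d} (P Q : Hom N d) → P -ₕ Q ≡ 0ₕ → P ≡ Q
  -ₕ≡0ₕ⇒≡ (const a)    (const b)    eq = cong const (x∙y⁻¹≈ε⇒x≈y a b (const-injective eq))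
  -ₕ≡0ₕ⇒≡ empty        empty        _  = refl
  -ₕ≡0ₕ⇒≡ (P₀ +x₀* P₁) (Q₀ +x₀* Q₁) eq with +x₀*-injective eq
  ... | eq₀ , eq₁ = cong₂ _+x₀*_ (-ₕ≡0ₕ⇒≡ P₀ Q₀ eq₀) (-ₕ≡0ₕ⇒≡ P₁ Q₁ eq₁)

  line : ∀ {n} → Pt F n → Pt F n → Carrier → Pt F n
  line x v s = _⊕_ F x (_·_ F s v)

  -- Homogeneity is what makes the leading coefficient of P along the line X + sV equal to P(V).
  eval-line : ∀ {N d} (P : Hom N d) (X V : Pt F N) → ∃ λ (cs : Vec Carrier d) →
    ∀ s → eval P (line X V s) ≡ horner cs (eval P V) s
  eval-line (const c) X V = [] , λ _ → refl
  eval-line {d = d} empty [] [] = replicate d 0# , λ s → sym (horner-zeros d s)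
  eval-line (P₀ +x₀* P₁) (x ∷ X) (v ∷ V) with eval-line P₀ X V | eval-line P₁ (x ∷ X) (v ∷ V)
  ... | cs₀ , restrict₀ | cs₁ , restrict₁ with horner-+-affine* cs₀ (eval P₀ V) cs₁ (eval P₁ (v ∷ V)) x v
  ... | cs , combine = cs , λ s →
    trans (cong₂ (λ a b → a + (x + s * v) * b) (restrict₀ s) (restrict₁ s)) (combine s)

  allElements : List Carrier
  allElements = L.map (Inverse.to enum) (allFin size)

  allElements-unique : Unique allElements
  allElements-unique = map⁺ (to-injective enum) (allFin⁺ size)

  length-allElements : length allElements ≡ size
  length-allElements = trans (length-map _ (allFin size)) (length-tabulate id)

  vanishes-on-line⇒at-direction : ∀ {N d} (P : Hom N d) → d < size → (X V : Pt F N) →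
    (∀ s → eval P (line X V s) ≡ 0#) → eval P V ≡ 0#
  vanishes-on-line⇒at-direction {d = d} P d<size X V vanishes with eval-line P X V
  ... | cs , restriction = leading-coefficient≡0 cs (eval P V) allElements-unique
    (subst (d <_) (sym length-allElements) d<size) (λ {s} _ → trans (sym (restriction s)) (vanishes s))

  -- P₀ = P(0, ·) is the leading form of the dehomogenisation P(1, ·).
  leading-form-vanishes : ∀ {N d} (P₀ : Hom N (suc d)) P₁ → suc d < size → (X V : Pt F N) →
    (∀ s → eval (P₀ +x₀* P₁) (1# ∷ line X V s) ≡ 0#) → eval P₀ V ≡ 0#
  leading-form-vanishes P₀ P₁ d<size X V vanishes = begin
    eval P₀ V                   ≡⟨ +-identityʳ _ ⟨
    eval P₀ V + 0#              ≡⟨ cong (eval P₀ V +_) (zeroˡ (eval P₁ (0# ∷ V))) ⟨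
    eval P (0# ∷ V)             ≡⟨ vanishes-on-line⇒at-direction P d<size (1# ∷ X) (0# ∷ V) vanishes′ ⟩
    0#                          ∎
    where
    P = P₀ +x₀* P₁
    1+s*0≡1 : ∀ s → 1# + s * 0# ≡ 1#
    1+s*0≡1 s = trans (cong (1# +_) (zeroʳ s)) (+-identityʳ 1#)
    vanishes′ : ∀ s → eval P (line (1# ∷ X) (0# ∷ V) s) ≡ 0#
    vanishes′ s = trans (cong (λ x₀ → eval P (x₀ ∷ line X V s)) (1+s*0≡1 s)) (vanishes s)

  quotient-vanishes-at-1∷ : ∀ {N d} (P₀ : Hom N (suc d)) P₁ {a} → eval P₀ a ≡ 0# →
    eval (P₀ +x₀* P₁) (1# ∷ a) ≡ 0# → eval P₁ (1# ∷ a) ≡ 0#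
  quotient-vanishes-at-1∷ P₀ P₁ {a} P₀-vanishes P-vanishes = begin
    eval P₁ (1# ∷ a)                  ≡⟨ *-identityˡ _ ⟨
    1# * eval P₁ (1# ∷ a)             ≡⟨ +-identityˡ _ ⟨
    0# + 1# * eval P₁ (1# ∷ a)        ≡⟨ cong (_+ 1# * eval P₁ (1# ∷ a)) P₀-vanishes ⟨
    eval (P₀ +x₀* P₁) (1# ∷ a)        ≡⟨ P-vanishes ⟩
    0#                                ∎

  mutual
    dehomogenisation-vanishes⇒≡0ₕ : ∀ {N d} (P : Hom (suc N) d) → d < size →
      (∀ a → eval P (1# ∷ a) ≡ 0#) → P ≡ 0ₕ
    dehomogenisation-vanishes⇒≡0ₕ {N} (const c) _ vanishes = cong const (vanishes (zeroVec F N))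
    dehomogenisation-vanishes⇒≡0ₕ {N} (P₀ +x₀* P₁) d<size vanishes =
      cong₂ _+x₀*_ (vanishes⇒≡0ₕ P₀ d<size P₀-vanishes)
                   (dehomogenisation-vanishes⇒≡0ₕ P₁ (ℕ.<⇒≤ d<size) P₁-vanishes)
      where
      P₀-vanishes : ∀ v → eval P₀ v ≡ 0#
      P₀-vanishes v = leading-form-vanishes P₀ P₁ d<size (zeroVec F N) v (vanishes ∘ line (zeroVec F N) v)
      P₁-vanishes : ∀ a → eval P₁ (1# ∷ a) ≡ 0#
      P₁-vanishes a = quotient-vanishes-at-1∷ P₀ P₁ (P₀-vanishes a) (vanishes a)

    vanishes⇒≡0ₕ : ∀ {N d} (P : Hom N d) → d < size → (∀ v → eval P v ≡ 0#) → P ≡ 0ₕ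
    vanishes⇒≡0ₕ {zero}  (const c) _      vanishes = cong const (vanishes [])
    vanishes⇒≡0ₕ {zero}  empty     _      _        = refl
    vanishes⇒≡0ₕ {suc N} P         d<size vanishes =
      dehomogenisation-vanishes⇒≡0ₕ P d<size (vanishes ∘ (1# ∷_))

  _VanishesOn_ : ∀ {n d} → Hom (suc n) d → (Pt F n → Set) → Set
  P VanishesOn E = ∀ {x} → E x → eval P (1# ∷ x) ≡ 0#

  -- Only the directions 1 ∷ a, those transversal to the hyperplane x₀ = 0, are asked for: the argument
  -- never uses the others.
  IsKakeyaSet : ∀ {n} → (Pt F (suc n) → Set) → Set
  IsKakeyaSet {n} E = ∀ (a : Pt F n) → ∃ λ x → ∀ s → E (line x (1# ∷ a) s)

  kakeya-vanishing⇒≡0ₕ : ∀ {n d} {E : Pt F (suc n) → Set} → IsKakeyaSet E →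
    (P : Hom (suc (suc n)) d) → d < size → P VanishesOn E → P ≡ 0ₕ
  kakeya-vanishing⇒≡0ₕ {n} kakeya (const c) _ vanishes = cong const (vanishes (proj₂ (kakeya (zeroVec F n)) 0#))
  kakeya-vanishing⇒≡0ₕ {E = E} kakeya (P₀ +x₀* P₁) d<size vanishes =
    cong₂ _+x₀*_ P₀≡0ₕ (kakeya-vanishing⇒≡0ₕ kakeya P₁ (ℕ.<⇒≤ d<size) P₁-vanishes)
    where
    P₀≡0ₕ : P₀ ≡ 0ₕ
    P₀≡0ₕ = dehomogenisation-vanishes⇒≡0ₕ P₀ d<size λ a → let x , line⊆E = kakeya a in
      leading-form-vanishes P₀ P₁ d<size x (1# ∷ a) (vanishes ∘ line⊆E)
    P₁-vanishes : P₁ VanishesOn E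
    P₁-vanishes {x} x∈E = quotient-vanishes-at-1∷ P₀ P₁ (eval-≡0ₕ P₀≡0ₕ x) (vanishes x∈E)

  toVec : ∀ {N d} → Hom N d → Vec Carrier (monomialCount N d)
  toVec (const c)    = c ∷ []
  toVec empty        = []
  toVec (P₀ +x₀* P₁) = toVec P₀ V.++ toVec P₁

  fromVec : ∀ N d → Vec Carrier (monomialCount N d) → Hom N d
  fromVec _       zero    (c ∷ []) = const c
  fromVec zero    (suc d) []       = empty
  fromVec (suc N) (suc d) cs       =
    fromVec N (suc d) (V.take (monomialCount N (suc d)) cs)
      +x₀* fromVec (suc N) d (V.drop (monomialCount N (suc d)) cs)

  toVec-fromVec : ∀ N d cs → toVec (fromVec N d cs) ≡ cs
  toVec-fromVec _       zero    (c ∷ []) = refl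
  toVec-fromVec zero    (suc d) []       = refl
  toVec-fromVec (suc N) (suc d) cs       =
    trans (cong₂ V._++_ (toVec-fromVec N (suc d) _) (toVec-fromVec (suc N) d _))
          (V.take++drop≡id (monomialCount N (suc d)) cs)

  1<size : 1 < size
  1<size = Fin↔-distinct⇒1< enum 0≢1

  open Finite enum using (Vec-injection⇒≤)

  evaluations : ∀ {n d} (E : List (Pt F n)) → Hom (suc n) d → Vec Carrier (length E)
  evaluations E P = V.map (λ x → eval P (1# ∷ x)) (V.fromList E)

  -- Counting replaces linear algebra: evaluation on E is injective, so |F| ^ monomialCount ≤ |F| ^ length E.
  monomialCount≤length : ∀ {n d} (E : List (Pt F n)) →
    (∀ (P : Hom (suc n) d) → P VanishesOn (_∈ E) → P ≡ 0ₕ) → monomialCount (suc n) d ≤ length E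
  monomialCount≤length {n} {d} E only-0ₕ-vanishes =
    Vec-injection⇒≤ 1<size (evaluations E ∘ fromVec (suc n) d) evaluations-injective
    where
    evaluations-injective : Injective _≡_ _≡_ (evaluations E ∘ fromVec (suc n) d)
    evaluations-injective {u} {v} same-values = begin
      u        ≡⟨ toVec-fromVec (suc n) d u ⟨
      toVec P  ≡⟨ cong toVec (-ₕ≡0ₕ⇒≡ P Q (only-0ₕ-vanishes (P -ₕ Q) P-Q-vanishes)) ⟩
      toVec Q  ≡⟨ toVec-fromVec (suc n) d v ⟩
      v        ∎
      where
      P = fromVec (suc n) d u
      Q = fromVec (suc n) d v
      P-Q-vanishes : (P -ₕ Q) VanishesOn (_∈ E)
      P-Q-vanishes x∈E = trans (eval--ₕ P Q _) (x≈y⇒x∙y⁻¹≈ε (map-fromList-≡⇒≡ _ _ E same-values x∈E))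

  0·v≡0 : ∀ {m} (v : Pt F m) → _·_ F 0# v ≡ zeroVec F m
  0·v≡0 v = trans (V.map-cong zeroˡ v) (V.map-const v 0#)

  lincomb-zeros : ∀ {m j} (ws : Vec (Pt F m) j) → lincomb F (replicate j 0#) ws ≡ zeroVec F m
  lincomb-zeros []       = refl
  lincomb-zeros (w ∷ ws) = trans (cong₂ (_⊕_ F) (0·v≡0 w) (lincomb-zeros ws)) (V.zipWith-identityˡ +-identityˡ _)

  lincomb-0∷ : ∀ {m j} ts (ws : Vec (Pt F m) j) → lincomb F ts (V.map (0# ∷_) ws) ≡ 0# ∷ lincomb F ts ws
  lincomb-0∷ []       []       = refl
  lincomb-0∷ (t ∷ ts) (w ∷ ws) =
    trans (cong (_⊕_ F (_·_ F t (0# ∷ w))) (lincomb-0∷ ts ws))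
          (cong (_∷ _⊕_ F (_·_ F t w) (lincomb F ts ws)) (trans (+-identityʳ (t * 0#)) (zeroʳ t)))

  linIndep-extend : ∀ {m j} (a : Pt F m) (ws : Vec (Pt F m) j) → LinIndep F ws →
    LinIndep F ((1# ∷ a) ∷ V.map (0# ∷_) ws)
  linIndep-extend {m} a ws ws-indep (t ∷ ts) combination≡0 = cong₂ _∷_ t≡0 (ws-indep ts rest≡0)
    where
    coordinates : (t * 1# + 0#) ∷ _⊕_ F (_·_ F t a) (lincomb F ts ws) ≡ 0# ∷ zeroVec F m
    coordinates = trans (cong (_⊕_ F (_·_ F t (1# ∷ a))) (sym (lincomb-0∷ ts ws))) combination≡0
    t≡0 : t ≡ 0#
    t≡0 = trans (sym (trans (+-identityʳ _) (*-identityʳ t))) (V.∷-injectiveˡ coordinates)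
    t·a≡0 : _·_ F t a ≡ zeroVec F m
    t·a≡0 = trans (cong (λ c → _·_ F c a) t≡0) (0·v≡0 a)
    rest≡0 : lincomb F ts ws ≡ zeroVec F m
    rest≡0 = begin
      lincomb F ts ws                        ≡⟨ V.zipWith-identityˡ +-identityˡ _ ⟨
      _⊕_ F (zeroVec F m) (lincomb F ts ws)  ≡⟨ cong (λ v → _⊕_ F v (lincomb F ts ws)) t·a≡0 ⟨
      _⊕_ F (_·_ F t a) (lincomb F ts ws)    ≡⟨ V.∷-injectiveʳ coordinates ⟩
      zeroVec F m                            ∎

  linIndep-of-length : ∀ {j m} → j ≤ m → Σ (Vec (Pt F m) j) (LinIndep F)
  linIndep-of-length z≤n = [] , λ { [] _ → refl }
  linIndep-of-length {suc j} {suc m} (s≤s j≤m) = let ws , ws-indep = linIndep-of-length j≤m in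
    (1# ∷ zeroVec F m) ∷ V.map (0# ∷_) ws , linIndep-extend (zeroVec F m) ws ws-indep

  nkSet⇒kakeya : ∀ {m j} → j ≤ m → (E : List (Pt F (suc m))) → IsNKSet F (suc m) (suc j) E →
    IsKakeyaSet (_∈ E)
  nkSet⇒kakeya {m} {j} j≤m E nk a with linIndep-of-length j≤m
  ... | ws , ws-indep with nk ((1# ∷ a) ∷ V.map (0# ∷_) ws) (linIndep-extend a ws ws-indep)
  ... | x , x+π⊆E = x , λ s → subst (_∈ E) (cong (_⊕_ F x) (on-line s)) (x+π⊆E _ (s ∷ replicate j 0# , refl))
    where
    on-line : ∀ s → lincomb F (s ∷ replicate j 0#) ((1# ∷ a) ∷ V.map (0# ∷_) ws) ≡ _·_ F s (1# ∷ a)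
    on-line s = trans (cong (_⊕_ F (_·_ F s (1# ∷ a))) (lincomb-zeros (V.map (0# ∷_) ws)))
                      (V.zipWith-identityʳ +-identityʳ _)

open PolynomialMethod using (IsKakeyaSet; kakeya-vanishing⇒≡0ₕ; monomialCount≤length; nkSet⇒kakeya; 1<size)

open import Data.Nat using (_+_; _*_; _∸_; NonZero; >-nonZero; z<s)
open import Data.Nat.Properties
open import Data.Nat.Tactic.RingSolver using (solve-∀)

kakeya-bound : (F : FiniteField) {n : ℕ} (E : List (Pt F (suc n))) → IsKakeyaSet F (_∈ E) →
  FiniteField.size F ^ suc n ≤ suc n ^ suc n * length E
kakeya-bound F {n} E kakeya = ≤-trans (^≤^*monomialCount (suc n) size)
  (*-monoʳ-≤ (suc n ^ suc n) (monomialCount≤length F E λ P → kakeya-vanishing⇒≡0ₕ F kakeya P size∸1<size))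
  where
  open FiniteField F using (size)
  size∸1<size : size ∸ 1 < size
  size∸1<size = ∸-monoʳ-< z<s (<⇒≤ (1<size F))

nkSet-bound : (F : FiniteField) {n k : ℕ} → 1 ≤ k → k ≤ n → (E : List (Pt F n)) → IsNKSet F n k E →
  FiniteField.size F ^ n ≤ n ^ n * length E
nkSet-bound F (s≤s z≤n) (s≤s j≤n) E nk = kakeya-bound F E (nkSet⇒kakeya F j≤n E nk)

nkSet-exponent≤ : ∀ {k n} q → k + 1 ≤ n → q * (k * n + k + 1) ≤ n * (q * (k + 1))
nkSet-exponent≤ {k} {n} q k+1≤n = begin
  q * (k * n + k + 1)    ≡⟨ cong (q *_) (+-assoc (k * n) k 1) ⟩
  q * (k * n + (k + 1))  ≤⟨ *-monoʳ-≤ q (+-monoʳ-≤ (k * n) k+1≤n) ⟩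
  q * (k * n + n)        ≡⟨ rearrange q k n ⟩
  n * (q * (k + 1))      ∎
  where
  open ≤-Reasoning
  rearrange : ∀ q k n → q * (k * n + n) ≡ n * (q * (k + 1))
  rearrange = solve-∀

corollary1p11 : (n k : ℕ) → 2 ≤ k → k + 2 ≤ n →
    (p q : ℕ) → 1 ≤ p → 1 ≤ q →
    ∃ λ (C : ℕ) → ∀ (F : FiniteField) (E : List (Pt F n)) → Unique E → IsNKSet F n k E →
      FiniteField.size F ^ (q * (k * n + k + 1))
        ≤ C * FiniteField.size F ^ (p * (k + 1)) * length E ^ (q * (k + 1))
corollary1p11 n k 2≤k k+2≤n p q _ _ = (n ^ n) ^ e , λ F E _ → bound F E
  where
  e = q * (k + 1)
  f = p * (k + 1)
  1≤k : 1 ≤ k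
  1≤k = ≤-trans (n≤1+n 1) 2≤k
  k≤n : k ≤ n
  k≤n = ≤-trans (m≤m+n k 2) k+2≤n
  k+1≤n : k + 1 ≤ n
  k+1≤n = ≤-trans (+-monoʳ-≤ k (n≤1+n 1)) k+2≤n
  bound : ∀ F E → IsNKSet F n k E →
    FiniteField.size F ^ (q * (k * n + k + 1)) ≤ (n ^ n) ^ e * FiniteField.size F ^ f * length E ^ e
  bound F E nk = begin
    S ^ (q * (k * n + k + 1))       ≤⟨ ^-monoʳ-≤ S (nkSet-exponent≤ q k+1≤n) ⟩
    S ^ (n * e)                     ≡⟨ ^-*-assoc S n e ⟨
    (S ^ n) ^ e                     ≤⟨ ^-monoˡ-≤ e (nkSet-bound F 1≤k k≤n E nk) ⟩
    (n ^ n * length E) ^ e          ≡⟨ ^-distribʳ-* (n ^ n) (length E) e ⟩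
    (n ^ n) ^ e * length E ^ e      ≤⟨ *-monoˡ-≤ (length E ^ e) (m≤m*n ((n ^ n) ^ e) (S ^ f) {{m^n≢0 S f}}) ⟩
    (n ^ n) ^ e * S ^ f * length E ^ e ∎
    where
    open ≤-Reasoning
    S = FiniteField.size F
    instance
      S-nonZero : NonZero S
      S-nonZero = >-nonZero (<⇒≤ (1<size F))
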